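{- Let $q$ be a prime power and, for integers $r,s,t,u$, let $\Omega_{r,s,t,u}$ be as in the context. Then $\#\Omega_{r,s,t,u}=\#\Omega_{u,t,s,r}$.
   Context: $q$ is a power of a prime. For integers $r,s,t,u$, $\Omega_{r,s,t,u}=\{(i,j,k)\in\mathbb{Z}^3: -r\le i,\ -s\le i+(q^2+q)k<-s+(q^2+q),\ -t\le qi+(q^2+q)j+(q+1)k<-t+(q^2+q),\ -u\le -q^2i-(q^3-q)j-(q^3+q^2-q-1)k\}$. -}

module Defs where

open import Data.Nat as ℕ using (ℕ; _^_)
open import Data.Nat.Primality using (Prime)
open import Data.Integer using (ℤ; +_; _+_; _*_; -_; _-_; _≤_; _<_)
open import Data.Product using (Σ; ∃; ∃-syntax; _×_)
open import Data.Fin using (Fin)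
open import Function.Bundles using (_↔_)
open import Relation.Binary.PropositionalEquality using (_≡_)

IsPrimePower : ℕ → Set
IsPrimePower q = ∃[ p ] ∃[ m ] (Prime p × 1 ℕ.≤ m × q ≡ p ^ m)

InΩ : ℕ → ℤ → ℤ → ℤ → ℤ → ℤ × ℤ × ℤ → Set
InΩ q r s t u (i Data.Product., j Data.Product., k) =
  (- r ≤ i)
  × (- s ≤ i + (Q * Q + Q) * k) × (i + (Q * Q + Q) * k < - s + (Q * Q + Q))
  × (- t ≤ Q * i + (Q * Q + Q) * j + (Q + + 1) * k)
  × (Q * i + (Q * Q + Q) * j + (Q + + 1) * k < - t + (Q * Q + Q))
  × (- u ≤ - (Q * Q) * i - (Q * Q * Q - Q) * j - (Q * Q * Q + Q * Q - Q - + 1) * k)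
  where Q = + q

Ω : ℕ → ℤ → ℤ → ℤ → ℤ → Set
Ω q r s t u = Σ (ℤ × ℤ × ℤ) (InΩ q r s t u)

HasCard : Set → ℕ → Set
HasCard A n = Fin n ↔ A

module Submission where

open import Defs
open import Data.Nat using (ℕ)
open import Data.Integer using (ℤ)
open import Data.Product using (∃-syntax; _×_)

open import Data.Nat as ℕ using (suc; z≤n; s≤s)
import Data.Nat.Properties as ℕ
open import Data.Nat.Primality using (prime⇒nonZero)
open import Data.Integer
  using (+_; -[1+_]; +≤+; -≤-; ∣_∣; _+_; _-_; _*_; -_; _≤_; _<_; _≤?_; _<?_)
open import Data.Integer.Properties
  using (≤-irrelevant; <-irrelevant; abs-*; ∣i-j∣≤∣i∣+∣j∣; i≤j⇒0≤j-i; 0≤i-j⇒j≤i; <⇒≤; +◃n≡+n)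
  renaming (_≟_ to _≟ℤ_)
open import Data.Integer.Tactic.RingSolver using (solve-∀)
open import Data.Fin using (Fin)
open import Data.List using (List; _∷_; length; lookup; filter; deduplicate; map; upTo; _++_; cartesianProduct)
open import Data.List.Relation.Unary.Any using (index)
open import Data.List.Relation.Unary.Any.Properties using (lookup-index)
open import Data.List.Relation.Unary.Unique.Propositional using (Unique)
open import Data.List.Relation.Unary.Unique.DecPropositional.Properties using (deduplicate-!)
open import Data.List.Membership.Propositional using (_∈_)
open import Data.List.Membership.Propositional.Properties
  using (∈-lookup; ∈-filter⁺; ∈-filter⁻; ∈-deduplicate⁺; ∈-deduplicate⁻; ∈-++⁺ˡ; ∈-++⁺ʳ; ∈-map⁺; ∈-upTo⁺; ∈-cartesianProduct⁺)
open import Data.List.Membership.Propositional.Properties.WithK using (unique⇒irrelevant)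
open import Data.Product using (Σ; _,_; proj₁; proj₂)
open import Data.Product.Properties using (Σ-≡,≡→≡; ≡-dec)
open import Function.Bundles using (_↔_; mk↔ₛ′)
open import Function.Construct.Composition using (_↔-∘_)
open import Relation.Nullary.Decidable using (_×-dec_)
open import Relation.Unary using (Decidable; Irrelevant)
open import Relation.Binary.Definitions using (DecidableEquality)
open import Relation.Binary.PropositionalEquality
  using (_≡_; refl; sym; trans; cong; cong₂; subst)

-- Write Q = q, N = Q² + Q, and for x = (i, j, k) ∈ ℤ³ consider the
-- four linear forms cutting out Ω_{r,s,t,u}:
--   i,   A(x) = i + N k,   B(x) = Q i + N j + (Q + 1) k,   C(x) = -Q² i - (Q³-Q) j - (Q³+Q²-Q-1) k,
-- so that x ∈ Ω_{r,s,t,u} iff -r ≤ i, -s ≤ A < -s + N, -t ≤ B < -t + N, -u ≤ C.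
-- There is an integral linear involution `dual` of ℤ³ with
--   i ∘ dual = C,   A ∘ dual = B,   B ∘ dual = A,   C ∘ dual = i,
-- (all polynomial identities in Q, checked by the ring solver), so `dual` maps
-- Ω_{r,s,t,u} bijectively onto Ω_{u,t,s,r}; this holds for every q.
-- For q ≥ 1 (in particular for prime powers) Ω_{r,s,t,u} is finite: the identity
-- C = -i - (Q-1)(A+B) bounds i from above, and N k = A - i, N j = B - Q i - (Q+1) k
-- then bound j and k.  A decidable, proof-irrelevant predicate whose witnesses all lie
-- in a known list has a finite total space, which gives the common cardinality.

index-∈-lookup : {X : Set} (xs : List X) (i : Fin (length xs)) → index (∈-lookup {xs = xs} i) ≡ i
index-∈-lookup (x ∷ xs) Fin.zero    = refl
index-∈-lookup (x ∷ xs) (Fin.suc i) = cong Fin.suc (index-∈-lookup xs i)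

enumerate-unique : {X : Set} {xs : List X} → Unique xs → Fin (length xs) ↔ Σ X (_∈ xs)
enumerate-unique {X} {xs} unique = mk↔ₛ′ to from to∘from from∘to
  where
  to : Fin (length xs) → Σ X (_∈ xs)
  to i = lookup xs i , ∈-lookup i
  from : Σ X (_∈ xs) → Fin (length xs)
  from (_ , x∈xs) = index x∈xs
  to∘from : ∀ y → to (from y) ≡ y
  to∘from (x , x∈xs) = Σ-≡,≡→≡ (sym (lookup-index x∈xs) , unique⇒irrelevant unique _ _)
  from∘to : ∀ i → from (to i) ≡ i
  from∘to = index-∈-lookup xs

Σ-↔-irrelevant : {X : Set} {P R : X → Set} → Irrelevant P → Irrelevant R →
  (∀ {x} → P x → R x) → (∀ {x} → R x → P x) → Σ X P ↔ Σ X R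
Σ-↔-irrelevant irrP irrR P⇒R R⇒P = mk↔ₛ′
  (λ (x , p) → x , P⇒R p) (λ (x , r) → x , R⇒P r)
  (λ (x , r) → cong (x ,_) (irrR _ r)) (λ (x , p) → cong (x ,_) (irrP _ p))

finite-subtype : {X : Set} → DecidableEquality X → (P : X → Set) → Decidable P → Irrelevant P →
  (xs : List X) → (∀ {x} → P x → x ∈ xs) → ∃[ n ] (Fin n ↔ Σ X P)
finite-subtype _≟_ P P? irrP xs covered =
  length witnesses , Σ-↔-irrelevant (unique⇒irrelevant unique) irrP from-list to-list ↔-∘ enumerate-unique unique
  where
  witnesses : List _
  witnesses = deduplicate _≟_ (filter P? xs)
  unique : Unique witnesses
  unique = deduplicate-! _≟_ (filter P? xs)
  from-list : ∀ {x} → x ∈ witnesses → P x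
  from-list m = proj₂ (∈-filter⁻ P? {xs = xs} (∈-deduplicate⁻ _≟_ (filter P? xs) m))
  to-list : ∀ {x} → P x → x ∈ witnesses
  to-list p = ∈-deduplicate⁺ _≟_ (∈-filter⁺ P? (covered p) p)

window : ℕ → List ℤ
window b = map +_ (upTo (suc b)) ++ map -[1+_] (upTo b)

∈-window : ∀ b x → ∣ x ∣ ℕ.≤ b → x ∈ window b
∈-window b (+ n)    n≤b = ∈-++⁺ˡ (∈-map⁺ +_ (∈-upTo⁺ (s≤s n≤b)))
∈-window b -[1+ n ] n<b = ∈-++⁺ʳ (map +_ (upTo (suc b))) (∈-map⁺ -[1+_] (∈-upTo⁺ n<b))

cube : ℕ → ℕ → ℕ → List (ℤ × ℤ × ℤ)
cube a b c = cartesianProduct (window a) (cartesianProduct (window b) (window c))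

∣x∣≤∣lo∣+∣hi∣ : ∀ {lo x hi} → lo ≤ x → x ≤ hi → ∣ x ∣ ℕ.≤ ∣ lo ∣ ℕ.+ ∣ hi ∣
∣x∣≤∣lo∣+∣hi∣ {lo} {+ n}    {+ m} _           (+≤+ n≤m) = ℕ.≤-trans n≤m (ℕ.m≤n+m m ∣ lo ∣)
∣x∣≤∣lo∣+∣hi∣ { -[1+ m ]} { -[1+ n ]} {hi} (-≤- n≤m) _ = ℕ.≤-trans (s≤s n≤m) (ℕ.m≤m+n (suc m) ∣ hi ∣)

∣z∣≤∣N*z∣ : ∀ N z .{{_ : ℕ.NonZero ∣ N ∣}} → ∣ z ∣ ℕ.≤ ∣ N * z ∣
∣z∣≤∣N*z∣ N z = ℕ.≤-trans (ℕ.m≤n*m ∣ z ∣ ∣ N ∣) (ℕ.≤-reflexive (sym (abs-* N z)))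

0≤a+n[b+c] : ∀ n {a b c} → + 0 ≤ a → + 0 ≤ b → + 0 ≤ c → + 0 ≤ a + + n * (b + c)
0≤a+n[b+c] n {+ a} {+ b} {+ c} _ _ _ rewrite +◃n≡+n (n ℕ.* (b ℕ.+ c)) = +≤+ z≤n

Point : Set
Point = ℤ × ℤ × ℤ

first : Point → ℤ
first (i , _ , _) = i

formA formB formC : ℤ → Point → ℤ
formA Q (i , j , k) = i + (Q * Q + Q) * k
formB Q (i , j , k) = Q * i + (Q * Q + Q) * j + (Q + + 1) * k
formC Q (i , j , k) = - (Q * Q) * i - (Q * Q * Q - Q) * j - (Q * Q * Q + Q * Q - Q - + 1) * k

dual : ℤ → Point → Point
dual Q x@(i , j , k) =
  formC Q x , (Q - + 1) * i + (Q * Q - Q - + 1) * j + (Q * Q - + 1) * k , i + Q * j + Q * k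

formA-dual : ∀ Q x → formA Q (dual Q x) ≡ formB Q x
formA-dual Q (i , j , k) = identity Q i j k
  where
  identity : ∀ Q i j k →
    (- (Q * Q) * i - (Q * Q * Q - Q) * j - (Q * Q * Q + Q * Q - Q - + 1) * k) + (Q * Q + Q) * (i + Q * j + Q * k)
      ≡ Q * i + (Q * Q + Q) * j + (Q + + 1) * k
  identity = solve-∀

formB-dual : ∀ Q x → formB Q (dual Q x) ≡ formA Q x
formB-dual Q (i , j , k) = identity Q i j k
  where
  identity : ∀ Q i j k →
    Q * (- (Q * Q) * i - (Q * Q * Q - Q) * j - (Q * Q * Q + Q * Q - Q - + 1) * k)
      + (Q * Q + Q) * ((Q - + 1) * i + (Q * Q - Q - + 1) * j + (Q * Q - + 1) * k)
      + (Q + + 1) * (i + Q * j + Q * k)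
      ≡ i + (Q * Q + Q) * k
  identity = solve-∀

formC-dual : ∀ Q x → formC Q (dual Q x) ≡ first x
formC-dual Q (i , j , k) = identity Q i j k
  where
  identity : ∀ Q i j k →
    - (Q * Q) * (- (Q * Q) * i - (Q * Q * Q - Q) * j - (Q * Q * Q + Q * Q - Q - + 1) * k)
      - (Q * Q * Q - Q) * ((Q - + 1) * i + (Q * Q - Q - + 1) * j + (Q * Q - + 1) * k)
      - (Q * Q * Q + Q * Q - Q - + 1) * (i + Q * j + Q * k)
      ≡ i
  identity = solve-∀

dual-involutive : ∀ Q x → dual Q (dual Q x) ≡ x
dual-involutive Q x@(i , j , k) = cong₂ _,_ (formC-dual Q x) (cong₂ _,_ (second Q i j k) (third Q i j k))
  where
  second : ∀ Q i j k →
    (Q - + 1) * (- (Q * Q) * i - (Q * Q * Q - Q) * j - (Q * Q * Q + Q * Q - Q - + 1) * k)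
      + (Q * Q - Q - + 1) * ((Q - + 1) * i + (Q * Q - Q - + 1) * j + (Q * Q - + 1) * k)
      + (Q * Q - + 1) * (i + Q * j + Q * k)
      ≡ j
  second = solve-∀
  third : ∀ Q i j k →
    (- (Q * Q) * i - (Q * Q * Q - Q) * j - (Q * Q * Q + Q * Q - Q - + 1) * k)
      + Q * ((Q - + 1) * i + (Q * Q - Q - + 1) * j + (Q * Q - + 1) * k)
      + Q * (i + Q * j + Q * k)
      ≡ k
  third = solve-∀

dual-maps : ∀ q r s t u x → InΩ q r s t u x → InΩ q u t s r (dual (+ q) x)
dual-maps q r s t u x@(_ , _ , _) (r≤i , s≤A , A<s+N , t≤B , B<t+N , u≤C) =
  u≤C ,
  subst (- t ≤_) (sym (formA-dual Q x)) t≤B ,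
  subst (_< - t + N) (sym (formA-dual Q x)) B<t+N ,
  subst (- s ≤_) (sym (formB-dual Q x)) s≤A ,
  subst (_< - s + N) (sym (formB-dual Q x)) A<s+N ,
  subst (- r ≤_) (sym (formC-dual Q x)) r≤i
  where
  Q = + q
  N = Q * Q + Q

InΩ-irrelevant : ∀ q r s t u → Irrelevant (InΩ q r s t u)
InΩ-irrelevant q r s t u {_ , _ , _} (a₁ , a₂ , a₃ , a₄ , a₅ , a₆) (b₁ , b₂ , b₃ , b₄ , b₅ , b₆) =
  cong₂ _,_ (≤-irrelevant a₁ b₁) (cong₂ _,_ (≤-irrelevant a₂ b₂) (cong₂ _,_ (<-irrelevant a₃ b₃)
  (cong₂ _,_ (≤-irrelevant a₄ b₄) (cong₂ _,_ (<-irrelevant a₅ b₅) (≤-irrelevant a₆ b₆)))))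

Ω-duality : ∀ q r s t u → Ω q r s t u ↔ Ω q u t s r
Ω-duality q r s t u = mk↔ₛ′ (swap r s t u) (swap u t s r) (swap-swap u t s r) (swap-swap r s t u)
  where
  swap : ∀ r s t u → Ω q r s t u → Ω q u t s r
  swap r s t u (x , x∈Ω) = dual (+ q) x , dual-maps q r s t u x x∈Ω
  swap-swap : ∀ r s t u y → swap u t s r (swap r s t u y) ≡ y
  swap-swap r s t u (x , x∈Ω) = Σ-≡,≡→≡ (dual-involutive (+ q) x , InΩ-irrelevant q r s t u _ _)

-- formC = -i - (Q-1)(formA + formB): this bounds i from above on Ω.
formC-decomposition : ∀ Q x → formC Q x ≡ - first x - (Q - + 1) * (formA Q x + formB Q x)
formC-decomposition Q (i , j , k) = identity Q i j k
  where
  identity : ∀ Q i j k →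
    - (Q * Q) * i - (Q * Q * Q - Q) * j - (Q * Q * Q + Q * Q - Q - + 1) * k
      ≡ - i - (Q - + 1) * ((i + (Q * Q + Q) * k) + (Q * i + (Q * Q + Q) * j + (Q + + 1) * k))
  identity = solve-∀

-- On Ω_{r,s,t,u} with q = q₀ + 1, the first coordinate is at most u + q₀ (s + t), because
-- u + q₀ (s + t) - i = (C + u) + q₀ ((A + s) + (B + t)) is a sum of nonnegative slacks.
first-upper : ∀ q₀ r s t u x → InΩ (suc q₀) r s t u x → first x ≤ u + + q₀ * (s + t)
first-upper q₀ r s t u x@(i , _ , _) (_ , s≤A , _ , t≤B , _ , u≤C) =
  0≤i-j⇒j≤i (subst (+ 0 ≤_) (sym slack)
    (0≤a+n[b+c] q₀ (i≤j⇒0≤j-i u≤C) (i≤j⇒0≤j-i s≤A) (i≤j⇒0≤j-i t≤B)))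
  where
  Q : ℤ
  Q = + suc q₀
  identity : ∀ P i A B s t u → (u + P * (s + t)) - i ≡ ((- i - P * (A + B)) - - u) + P * ((A - - s) + (B - - t))
  identity = solve-∀
  slack : (u + + q₀ * (s + t)) - i ≡ (formC Q x - - u) + + q₀ * ((formA Q x - - s) + (formB Q x - - t))
  slack = trans (identity (+ q₀) i (formA Q x) (formB Q x) s t u)
    (cong (λ c → (c - - u) + + q₀ * ((formA Q x - - s) + (formB Q x - - t))) (sym (formC-decomposition Q x)))

-- For Q ≥ 1 the last two coordinates are controlled by the forms, since
-- N k = A - i and N j = B - Q i - (Q + 1) k with N = Q² + Q ≠ 0.
third-bound : ∀ q₀ i j k → let Q = + suc q₀ in
  ∣ k ∣ ℕ.≤ ∣ formA Q (i , j , k) ∣ ℕ.+ ∣ i ∣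
third-bound q₀ i j k = begin
  ∣ k ∣                ≤⟨ ∣z∣≤∣N*z∣ (Q * Q + Q) k ⟩
  ∣ (Q * Q + Q) * k ∣  ≡⟨ cong ∣_∣ (identity Q i k) ⟩
  ∣ A - i ∣            ≤⟨ ∣i-j∣≤∣i∣+∣j∣ A i ⟩
  ∣ A ∣ ℕ.+ ∣ i ∣      ∎
  where
  open ℕ.≤-Reasoning
  Q A : ℤ
  Q = + suc q₀
  A = formA Q (i , j , k)
  identity : ∀ Q i k → (Q * Q + Q) * k ≡ (i + (Q * Q + Q) * k) - i
  identity = solve-∀

second-bound : ∀ q₀ i j k → let Q = + suc q₀ in
  ∣ j ∣ ℕ.≤ ∣ formB Q (i , j , k) ∣ ℕ.+ ∣ Q ∣ ℕ.* ∣ i ∣ ℕ.+ ∣ Q + + 1 ∣ ℕ.* ∣ k ∣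
second-bound q₀ i j k = begin
  ∣ j ∣                                              ≤⟨ ∣z∣≤∣N*z∣ (Q * Q + Q) j ⟩
  ∣ (Q * Q + Q) * j ∣                                ≡⟨ cong ∣_∣ (identity Q i j k) ⟩
  ∣ (B - Q * i) - (Q + + 1) * k ∣                    ≤⟨ ∣i-j∣≤∣i∣+∣j∣ (B - Q * i) ((Q + + 1) * k) ⟩
  ∣ B - Q * i ∣ ℕ.+ ∣ (Q + + 1) * k ∣                ≤⟨ ℕ.+-monoˡ-≤ _ (∣i-j∣≤∣i∣+∣j∣ B (Q * i)) ⟩
  ∣ B ∣ ℕ.+ ∣ Q * i ∣ ℕ.+ ∣ (Q + + 1) * k ∣          ≡⟨ cong₂ (λ a b → ∣ B ∣ ℕ.+ a ℕ.+ b) (abs-* Q i) (abs-* (Q + + 1) k) ⟩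
  ∣ B ∣ ℕ.+ ∣ Q ∣ ℕ.* ∣ i ∣ ℕ.+ ∣ Q + + 1 ∣ ℕ.* ∣ k ∣ ∎
  where
  open ℕ.≤-Reasoning
  Q B : ℤ
  Q = + suc q₀
  B = formB Q (i , j , k)
  identity : ∀ Q i j k →
    (Q * Q + Q) * j ≡ ((Q * i + (Q * Q + Q) * j + (Q + + 1) * k) - Q * i) - (Q + + 1) * k
  identity = solve-∀

Ω-covered : ∀ q₀ r s t u → Σ (List Point) λ xs → ∀ {x} → InΩ (suc q₀) r s t u x → x ∈ xs
Ω-covered q₀ r s t u = cube bound-i bound-j bound-k , covered
  where
  Q N : ℤ
  Q = + suc q₀
  N = Q * Q + Q
  bound-i bound-A bound-B bound-j bound-k : ℕ
  bound-i = ∣ - r ∣ ℕ.+ ∣ u + + q₀ * (s + t) ∣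
  bound-A = ∣ - s ∣ ℕ.+ ∣ - s + N ∣
  bound-B = ∣ - t ∣ ℕ.+ ∣ - t + N ∣
  bound-k = bound-A ℕ.+ bound-i
  bound-j = bound-B ℕ.+ ∣ Q ∣ ℕ.* bound-i ℕ.+ ∣ Q + + 1 ∣ ℕ.* bound-k
  covered : ∀ {x} → InΩ (suc q₀) r s t u x → x ∈ cube bound-i bound-j bound-k
  covered {x@(i , j , k)} x∈Ω@(r≤i , s≤A , A<s+N , t≤B , B<t+N , _) =
    ∈-cartesianProduct⁺ (∈-window _ i i-bound)
      (∈-cartesianProduct⁺ (∈-window _ j j-bound) (∈-window _ k k-bound))
    where
    i-bound : ∣ i ∣ ℕ.≤ bound-i
    i-bound = ∣x∣≤∣lo∣+∣hi∣ r≤i (first-upper q₀ r s t u x x∈Ω)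
    A-bound : ∣ formA Q x ∣ ℕ.≤ bound-A
    A-bound = ∣x∣≤∣lo∣+∣hi∣ s≤A (<⇒≤ A<s+N)
    B-bound : ∣ formB Q x ∣ ℕ.≤ bound-B
    B-bound = ∣x∣≤∣lo∣+∣hi∣ t≤B (<⇒≤ B<t+N)
    k-bound : ∣ k ∣ ℕ.≤ bound-k
    k-bound = ℕ.≤-trans (third-bound q₀ i j k) (ℕ.+-mono-≤ A-bound i-bound)
    j-bound : ∣ j ∣ ℕ.≤ bound-j
    j-bound = ℕ.≤-trans (second-bound q₀ i j k)
      (ℕ.+-mono-≤ (ℕ.+-mono-≤ B-bound (ℕ.*-monoʳ-≤ ∣ Q ∣ i-bound)) (ℕ.*-monoʳ-≤ ∣ Q + + 1 ∣ k-bound))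

InΩ-dec : ∀ q r s t u → Decidable (InΩ q r s t u)
InΩ-dec q r s t u (i , j , k) =
  (- r ≤? i) ×-dec ((- s ≤? _) ×-dec ((_ <? _) ×-dec ((- t ≤? _) ×-dec ((_ <? _) ×-dec (- u ≤? _)))))

Ω-finite : ∀ q₀ r s t u → ∃[ n ] HasCard (Ω (suc q₀) r s t u) n
Ω-finite q₀ r s t u =
  finite-subtype (≡-dec _≟ℤ_ (≡-dec _≟ℤ_ _≟ℤ_)) (InΩ (suc q₀) r s t u) (InΩ-dec (suc q₀) r s t u)
    (InΩ-irrelevant (suc q₀) r s t u) (proj₁ (Ω-covered q₀ r s t u)) (proj₂ (Ω-covered q₀ r s t u))

Ω-equinumerous : ∀ {q} → 0 ℕ.< q → (r s t u : ℤ) →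
  ∃[ n ] (HasCard (Ω q r s t u) n × HasCard (Ω q u t s r) n)
Ω-equinumerous {suc q₀} _ r s t u =
  proj₁ finite , proj₂ finite , Ω-duality (suc q₀) r s t u ↔-∘ proj₂ finite
  where
  finite : ∃[ n ] HasCard (Ω (suc q₀) r s t u) n
  finite = Ω-finite q₀ r s t u

prime-power-positive : ∀ {q} → IsPrimePower q → 0 ℕ.< q
prime-power-positive (p , m , p-prime , _ , refl) = ℕ.m^n>0 p ⦃ prime⇒nonZero p-prime ⦄ m

lemma2p8 : (q : ℕ) → IsPrimePower q → (r s t u : ℤ) →
    ∃[ n ] (HasCard (Ω q r s t u) n × HasCard (Ω q u t s r) n)
lemma2p8 q q-prime-power = Ω-equinumerous (prime-power-positive q-prime-power)
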